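{- For all $n\in\mathbb{N}$ and all $\alpha,\beta\in\{0,1,2\}^{\mathbb{N}}$, if $\overline{\alpha}n=\overline{\beta}n$ then $|\Phi(\alpha)-\Phi(\beta)|\le 2^{ -n}$. That is, $\Phi\colon\{0,1,2\}^{\mathbb{N}}\to[0,1]$ is uniformly continuous with modulus $k\mapsto k$.
   Context: The setting is constructive. Real numbers are regular sequences. These are sequences of rationals $\langle r_n\rangle$ with $|r_n-r_{n+1}|\le2^{ -(n+1)}$, with equality $\langle r_n\rangle\simeq\langle q_n\rangle$ iff $|r_{n+1}-q_{n+1}|\le 2^{ -n}$ for all $n$, and with the usual constructive order. For a finite ternary sequence $s\in\{0,1,2\}^*$, define $N(\langle\rangle)=1$ and $N(s*\langle i\rangle)=2N(s)+(i-1)$ for $i\in\{0,1,2\}$. For $\alpha\in\{0,1,2\}^{\mathbb{N}}$, $\overline{\alpha}n$ is its initial segment of length $n$. Define $\Phi(\alpha)$ to be the regular sequence $\langle 2^{ -(n+1)}N(\overline{\alpha}n)\rangle_{n\in\mathbb{N}}$, which lies in $[0,1]$. -}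

module Defs where

open import Data.Nat using (ℕ; zero; suc)
open import Data.Fin using (Fin)
import Data.Fin as Fin
open import Data.Integer as ℤ using (ℤ; +_)
open import Data.List using (List; []; _∷_; foldl; applyUpTo)
open import Data.Rational using (ℚ; 1ℚ; ½; _*_; _-_; _+_; -_; ∣_∣; _≤_; _/_)

2⁻ : ℕ → ℚ
2⁻ zero    = 1ℚ
2⁻ (suc n) = ½ * 2⁻ n

-- Sequences of rationals (reals are the regular ones).
Seq : Set
Seq = ℕ → ℚ

Regular : Seq → Set
Regular r = ∀ n → ∣ r n - r (suc n) ∣ ≤ 2⁻ (suc n)

const : ℚ → Seq
const c _ = c

_−ℝ_ : Seq → Seq → Seq
(x −ℝ y) n = x (suc n) - y (suc n)

∣_∣ℝ : Seq → Seq
∣ x ∣ℝ n = ∣ x n ∣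

Nonneg : Seq → Set
Nonneg x = ∀ n → - 2⁻ n ≤ x n

_≤ℝ_ : Seq → Seq → Set
x ≤ℝ y = Nonneg (y −ℝ x)

Tern : Set
Tern = Fin 3

N : List Tern → ℤ
N = foldl (λ acc i → (+ 2) ℤ.* acc ℤ.+ (+ Fin.toℕ i ℤ.- + 1)) (+ 1)

initSeg : (ℕ → Tern) → ℕ → List Tern
initSeg α n = applyUpTo α n

Φ : (ℕ → Tern) → Seq
Φ α n = 2⁻ (suc n) * (N (initSeg α n) / 1)

-- Since N(s * ⟨i⟩) = 2 N(s) + (i − 1), the distance d_k = |N(ᾱk) − N(β̄k)| satisfies
-- d_{k+1} ≤ 2 d_k + 2, and d_n = 0 when ᾱn = β̄n; hence d_{n+j} ≤ 2^{j+1} − 2, so that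
-- |Φ(α)_k − Φ(β)_k| = 2^{-(k+1)} d_k ≤ 2^{-n} for every k (trivially for k ≤ n).
-- A termwise bound by 2^{-n} already gives the inequality of reals.

module Submission where

open import Defs
open import Data.Nat using (ℕ)
open import Relation.Binary.PropositionalEquality using (_≡_)

open import Algebra.Bundles using (CommutativeRing)
import Algebra.Properties.CommutativeSemigroup as CommSemigroupProperties
open import Data.Fin using (zero; suc; toℕ)
open import Data.Integer as ℤ using (ℤ; +_)
import Data.Integer.Properties as ℤ
open import Data.Integer.Tactic.RingSolver using (solve-∀)
open import Data.List using (_∷_)
open import Data.List.Properties using (foldl-∷ʳ; applyUpTo-∷ʳ; ∷-injective)
import Data.Nat as ℕ
import Data.Nat.Properties as ℕ
open import Data.Product using (_,_)
open import Data.Rational using (0ℚ; 1ℚ; ½; _*_; _-_; _+_; -_; ∣_∣; _≤_; _/_; *≤*; toℚᵘ; nonNegative)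
open import Data.Rational.Properties
import Data.Rational.Unnormalised as ℚᵘ
import Data.Rational.Unnormalised.Properties as ℚᵘ
open import Data.Sum using (inj₁; inj₂)
open import Relation.Binary.PropositionalEquality using (refl; sym; trans; cong; cong₂; subst₂; module ≡-Reasoning)

digit : Tern → ℤ
digit i = + toℕ i ℤ.- + 1

∣digit∣≤1 : ∀ i → ℤ.∣ digit i ∣ ℕ.≤ 1
∣digit∣≤1 zero             = ℕ.≤-refl
∣digit∣≤1 (suc zero)       = ℕ.z≤n
∣digit∣≤1 (suc (suc zero)) = ℕ.≤-refl

N-initSeg-suc : ∀ α k → N (initSeg α (ℕ.suc k)) ≡ + 2 ℤ.* N (initSeg α k) ℤ.+ digit (α k)
N-initSeg-suc α k = trans (cong N (sym (applyUpTo-∷ʳ α k))) (foldl-∷ʳ _ (+ 1) (α k) (initSeg α k))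

initSeg-≡-≤ : ∀ {k n} (α β : ℕ → Tern) → k ℕ.≤ n → initSeg α n ≡ initSeg β n → initSeg α k ≡ initSeg β k
initSeg-≡-≤ α β ℕ.z≤n       _  = refl
initSeg-≡-≤ α β (ℕ.s≤s k≤n) eq with ∷-injective eq
... | α0≡β0 , tail-eq = cong₂ _∷_ α0≡β0 (initSeg-≡-≤ (λ i → α (ℕ.suc i)) (λ i → β (ℕ.suc i)) k≤n tail-eq)

N-dist : (α β : ℕ → Tern) → ℕ → ℕ
N-dist α β k = ℤ.∣ N (initSeg α k) ℤ.- N (initSeg β k) ∣

∣2a+x-[2b+y]∣≤2∣a-b∣+∣x∣+∣y∣ : ∀ a b x y →
  ℤ.∣ (+ 2 ℤ.* a ℤ.+ x) ℤ.- (+ 2 ℤ.* b ℤ.+ y) ∣ ℕ.≤ 2 ℕ.* ℤ.∣ a ℤ.- b ∣ ℕ.+ (ℤ.∣ x ∣ ℕ.+ ℤ.∣ y ∣)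
∣2a+x-[2b+y]∣≤2∣a-b∣+∣x∣+∣y∣ a b x y = begin
  ℤ.∣ (+ 2 ℤ.* a ℤ.+ x) ℤ.- (+ 2 ℤ.* b ℤ.+ y) ∣   ≡⟨ cong ℤ.∣_∣ (regroup a b x y) ⟩
  ℤ.∣ + 2 ℤ.* (a ℤ.- b) ℤ.+ (x ℤ.- y) ∣           ≤⟨ ℤ.∣i+j∣≤∣i∣+∣j∣ (+ 2 ℤ.* (a ℤ.- b)) (x ℤ.- y) ⟩
  ℤ.∣ + 2 ℤ.* (a ℤ.- b) ∣ ℕ.+ ℤ.∣ x ℤ.- y ∣       ≤⟨ ℕ.+-mono-≤ (ℕ.≤-reflexive (ℤ.abs-* (+ 2) (a ℤ.- b))) ∣x-y∣≤∣x∣+∣y∣ ⟩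
  2 ℕ.* ℤ.∣ a ℤ.- b ∣ ℕ.+ (ℤ.∣ x ∣ ℕ.+ ℤ.∣ y ∣)   ∎
  where
  open ℕ.≤-Reasoning
  regroup : ∀ a b x y → (+ 2 ℤ.* a ℤ.+ x) ℤ.- (+ 2 ℤ.* b ℤ.+ y) ≡ + 2 ℤ.* (a ℤ.- b) ℤ.+ (x ℤ.- y)
  regroup = solve-∀
  ∣x-y∣≤∣x∣+∣y∣ : ℤ.∣ x ℤ.- y ∣ ℕ.≤ ℤ.∣ x ∣ ℕ.+ ℤ.∣ y ∣
  ∣x-y∣≤∣x∣+∣y∣ = ℕ.≤-trans (ℤ.∣i+j∣≤∣i∣+∣j∣ x (ℤ.- y)) (ℕ.≤-reflexive (cong (ℤ.∣ x ∣ ℕ.+_) (ℤ.∣-i∣≡∣i∣ y)))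

N-dist-suc : ∀ α β k → N-dist α β (ℕ.suc k) ℕ.≤ 2 ℕ.* N-dist α β k ℕ.+ 2
N-dist-suc α β k rewrite N-initSeg-suc α k | N-initSeg-suc β k =
  ℕ.≤-trans (∣2a+x-[2b+y]∣≤2∣a-b∣+∣x∣+∣y∣ (N (initSeg α k)) (N (initSeg β k)) (digit (α k)) (digit (β k)))
            (ℕ.+-monoʳ-≤ (2 ℕ.* N-dist α β k) (ℕ.+-mono-≤ (∣digit∣≤1 (α k)) (∣digit∣≤1 (β k))))

N-dist-after-common-prefix : ∀ {n} (α β : ℕ → Tern) → initSeg α n ≡ initSeg β n → ∀ j →
  N-dist α β (n ℕ.+ j) ℕ.+ 2 ℕ.≤ 2 ℕ.^ ℕ.suc j
N-dist-after-common-prefix {n} α β eq ℕ.zero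
  rewrite ℕ.+-identityʳ n | eq | ℤ.+-inverseʳ (N (initSeg β n)) = ℕ.≤-refl
N-dist-after-common-prefix {n} α β eq (ℕ.suc j) = begin
  N-dist α β (n ℕ.+ ℕ.suc j) ℕ.+ 2    ≡⟨ cong (λ m → N-dist α β m ℕ.+ 2) (ℕ.+-suc n j) ⟩
  N-dist α β (ℕ.suc (n ℕ.+ j)) ℕ.+ 2  ≤⟨ ℕ.+-monoˡ-≤ 2 (N-dist-suc α β (n ℕ.+ j)) ⟩
  2 ℕ.* d ℕ.+ 2 ℕ.+ 2                 ≡⟨ ℕ.+-assoc (2 ℕ.* d) 2 2 ⟩
  2 ℕ.* d ℕ.+ 2 ℕ.* 2                 ≡⟨ ℕ.*-distribˡ-+ 2 d 2 ⟨
  2 ℕ.* (d ℕ.+ 2)                     ≤⟨ ℕ.*-monoʳ-≤ 2 (N-dist-after-common-prefix α β eq j) ⟩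
  2 ℕ.^ ℕ.suc (ℕ.suc j)               ∎
  where
  open ℕ.≤-Reasoning
  d = N-dist α β (n ℕ.+ j)

toℚᵘ-/1 : ∀ i → toℚᵘ (i / 1) ℚᵘ.≃ ℚᵘ.mkℚᵘ i 0
toℚᵘ-/1 i = toℚᵘ-fromℚᵘ (ℚᵘ.mkℚᵘ i 0)

/1-homo-* : ∀ i j → (i ℤ.* j) / 1 ≡ (i / 1) * (j / 1)
/1-homo-* i j = toℚᵘ-injective (ℚᵘ.≃-trans (toℚᵘ-/1 (i ℤ.* j)) (ℚᵘ.≃-sym (begin-equality
  toℚᵘ ((i / 1) * (j / 1))                   ≃⟨ toℚᵘ-homo-* (i / 1) (j / 1) ⟩
  toℚᵘ (i / 1) ℚᵘ.* toℚᵘ (j / 1)             ≃⟨ ℚᵘ.*-cong (toℚᵘ-/1 i) (toℚᵘ-/1 j) ⟩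
  ℚᵘ.mkℚᵘ i 0 ℚᵘ.* ℚᵘ.mkℚᵘ j 0              ≃⟨ ℚᵘ.*≡* refl ⟩
  ℚᵘ.mkℚᵘ (i ℤ.* j) 0                         ∎)))
  where open ℚᵘ.≤-Reasoning

/1-homo-- : ∀ i j → (i ℤ.- j) / 1 ≡ (i / 1) - (j / 1)
/1-homo-- i j = toℚᵘ-injective (ℚᵘ.≃-trans (toℚᵘ-/1 (i ℤ.- j)) (ℚᵘ.≃-sym (begin-equality
  toℚᵘ ((i / 1) - (j / 1))                   ≃⟨ toℚᵘ-homo-+ (i / 1) (- (j / 1)) ⟩
  toℚᵘ (i / 1) ℚᵘ.+ toℚᵘ (- (j / 1))         ≃⟨ ℚᵘ.+-cong (toℚᵘ-/1 i) (ℚᵘ.≃-trans (toℚᵘ-homo‿- (j / 1)) (ℚᵘ.-‿cong (toℚᵘ-/1 j))) ⟩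
  ℚᵘ.mkℚᵘ i 0 ℚᵘ.- ℚᵘ.mkℚᵘ j 0              ≃⟨ ℚᵘ.*≡* (cong (ℤ._* + 1) (cong₂ ℤ._+_ (ℤ.*-identityʳ i) (ℤ.*-identityʳ (ℤ.- j)))) ⟩
  ℚᵘ.mkℚᵘ (i ℤ.- j) 0                         ∎)))
  where open ℚᵘ.≤-Reasoning

∣/1∣ : ∀ i → ∣ i / 1 ∣ ≡ + ℤ.∣ i ∣ / 1
∣/1∣ i = toℚᵘ-injective (ℚᵘ.≃-trans (toℚᵘ-homo-∣-∣ (i / 1)) (ℚᵘ.≃-trans (ℚᵘ.∣-∣-cong (toℚᵘ-/1 i)) (ℚᵘ.≃-sym (toℚᵘ-/1 _))))

/1-mono-≤ : ∀ {i j} → i ℤ.≤ j → i / 1 ≤ j / 1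
/1-mono-≤ {i} {j} i≤j = toℚᵘ-cancel-≤ (ℚᵘ.≤-respʳ-≃ (ℚᵘ.≃-sym (toℚᵘ-/1 j)) (ℚᵘ.≤-respˡ-≃ (ℚᵘ.≃-sym (toℚᵘ-/1 i))
  (ℚᵘ.*≤* (subst₂ ℤ._≤_ (sym (ℤ.*-identityʳ i)) (sym (ℤ.*-identityʳ j)) i≤j))))

0≤2⁻ : ∀ m → 0ℚ ≤ 2⁻ m
0≤2⁻ ℕ.zero    = *≤* (ℤ.+≤+ ℕ.z≤n)
0≤2⁻ (ℕ.suc m) = ≤-trans (≤-reflexive (sym (*-zeroʳ ½))) (*-monoˡ-≤-nonNeg ½ (0≤2⁻ m))

2⁻-+ : ∀ m k → 2⁻ (m ℕ.+ k) ≡ 2⁻ m * 2⁻ k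
2⁻-+ ℕ.zero    k = sym (*-identityˡ (2⁻ k))
2⁻-+ (ℕ.suc m) k = trans (cong (½ *_) (2⁻-+ m k)) (sym (*-assoc ½ (2⁻ m) (2⁻ k)))

2⁻*2^≡1 : ∀ m → 2⁻ m * (+ (2 ℕ.^ m) / 1) ≡ 1ℚ
2⁻*2^≡1 ℕ.zero    = refl
2⁻*2^≡1 (ℕ.suc m) = begin
  (½ * 2⁻ m) * (+ (2 ℕ.* 2 ℕ.^ m) / 1)          ≡⟨ cong (λ z → (½ * 2⁻ m) * (z / 1)) (ℤ.pos-* 2 (2 ℕ.^ m)) ⟩
  (½ * 2⁻ m) * ((+ 2 ℤ.* + (2 ℕ.^ m)) / 1)      ≡⟨ cong ((½ * 2⁻ m) *_) (/1-homo-* (+ 2) (+ (2 ℕ.^ m))) ⟩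
  (½ * 2⁻ m) * ((+ 2 / 1) * (+ (2 ℕ.^ m) / 1))  ≡⟨ interchange ½ (2⁻ m) (+ 2 / 1) (+ (2 ℕ.^ m) / 1) ⟩
  (½ * (+ 2 / 1)) * (2⁻ m * (+ (2 ℕ.^ m) / 1))  ≡⟨ cong (1ℚ *_) (2⁻*2^≡1 m) ⟩
  1ℚ * 1ℚ                                       ∎
  where
  open ≡-Reasoning
  open CommSemigroupProperties (CommutativeRing.*-commutativeSemigroup +-*-commutativeRing)

∣2⁻*z∣≤2⁻ : ∀ n j (z : ℤ) → ℤ.∣ z ∣ ℕ.≤ 2 ℕ.^ j → ∣ 2⁻ (n ℕ.+ j) * (z / 1) ∣ ≤ 2⁻ n
∣2⁻*z∣≤2⁻ n j z ∣z∣≤2^j = begin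
  ∣ 2⁻ (n ℕ.+ j) * (z / 1) ∣                  ≡⟨ ∣p*q∣≡∣p∣*∣q∣ (2⁻ (n ℕ.+ j)) (z / 1) ⟩
  ∣ 2⁻ (n ℕ.+ j) ∣ * ∣ z / 1 ∣                ≡⟨ cong₂ _*_ (0≤p⇒∣p∣≡p (0≤2⁻ (n ℕ.+ j))) (∣/1∣ z) ⟩
  2⁻ (n ℕ.+ j) * (+ ℤ.∣ z ∣ / 1)              ≤⟨ *-monoˡ-≤-nonNeg (2⁻ (n ℕ.+ j)) {{nonNegative (0≤2⁻ (n ℕ.+ j))}}
                                                   (/1-mono-≤ (ℤ.+≤+ ∣z∣≤2^j)) ⟩
  2⁻ (n ℕ.+ j) * (+ (2 ℕ.^ j) / 1)            ≡⟨ cong (_* (+ (2 ℕ.^ j) / 1)) (2⁻-+ n j) ⟩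
  (2⁻ n * 2⁻ j) * (+ (2 ℕ.^ j) / 1)           ≡⟨ *-assoc (2⁻ n) (2⁻ j) _ ⟩
  2⁻ n * (2⁻ j * (+ (2 ℕ.^ j) / 1))           ≡⟨ cong (2⁻ n *_) (2⁻*2^≡1 j) ⟩
  2⁻ n * 1ℚ                                   ≡⟨ *-identityʳ (2⁻ n) ⟩
  2⁻ n                                        ∎
  where open ≤-Reasoning

Φ-Φ : ∀ α β k → Φ α k - Φ β k ≡ 2⁻ (ℕ.suc k) * ((N (initSeg α k) ℤ.- N (initSeg β k)) / 1)
Φ-Φ α β k = begin
  c * (A / 1) - c * (B / 1)        ≡⟨ cong (_+_ (c * (A / 1))) (neg-distribʳ-* c (B / 1)) ⟩
  c * (A / 1) + c * - (B / 1)      ≡⟨ *-distribˡ-+ c (A / 1) (- (B / 1)) ⟨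
  c * ((A / 1) - (B / 1))          ≡⟨ cong (c *_) (/1-homo-- A B) ⟨
  c * ((A ℤ.- B) / 1)              ∎
  where
  open ≡-Reasoning
  c = 2⁻ (ℕ.suc k)
  A = N (initSeg α k)
  B = N (initSeg β k)

∣Φ-Φ∣≤2⁻-beyond : ∀ {n} (α β : ℕ → Tern) → initSeg α n ≡ initSeg β n → ∀ j →
  ∣ Φ α (n ℕ.+ j) - Φ β (n ℕ.+ j) ∣ ≤ 2⁻ n
∣Φ-Φ∣≤2⁻-beyond {n} α β eq j = begin
  ∣ Φ α (n ℕ.+ j) - Φ β (n ℕ.+ j) ∣     ≡⟨ cong ∣_∣ (Φ-Φ α β (n ℕ.+ j)) ⟩
  ∣ 2⁻ (ℕ.suc (n ℕ.+ j)) * (z / 1) ∣   ≡⟨ cong (λ m → ∣ 2⁻ m * (z / 1) ∣) (ℕ.+-suc n j) ⟨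
  ∣ 2⁻ (n ℕ.+ ℕ.suc j) * (z / 1) ∣     ≤⟨ ∣2⁻*z∣≤2⁻ n (ℕ.suc j) z (ℕ.m+n≤o⇒m≤o _ (N-dist-after-common-prefix α β eq j)) ⟩
  2⁻ n                                 ∎
  where
  open ≤-Reasoning
  z = N (initSeg α (n ℕ.+ j)) ℤ.- N (initSeg β (n ℕ.+ j))

∣Φ-Φ∣≤2⁻ : ∀ {n} (α β : ℕ → Tern) → initSeg α n ≡ initSeg β n → ∀ k → ∣ Φ α k - Φ β k ∣ ≤ 2⁻ n
∣Φ-Φ∣≤2⁻ {n} α β eq k with ℕ.≤-total k n
... | inj₁ k≤n rewrite initSeg-≡-≤ α β k≤n eq | +-inverseʳ (Φ β k) = 0≤2⁻ n
... | inj₂ n≤k with ℕ.≤⇒≤″ n≤k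
... | record { quotient = j ; equality = refl } = ∣Φ-Φ∣≤2⁻-beyond α β eq j

p≤q⇒-r≤q-p : ∀ {p q} r → 0ℚ ≤ r → p ≤ q → - r ≤ q - p
p≤q⇒-r≤q-p {p} {q} r 0≤r p≤q = begin
  - r     ≤⟨ neg-antimono-≤ 0≤r ⟩
  0ℚ      ≡⟨ +-inverseʳ p ⟨
  p - p   ≤⟨ +-monoˡ-≤ (- p) p≤q ⟩
  q - p   ∎
  where open ≤-Reasoning

≤ℝ-const : ∀ (x : Seq) c → (∀ k → x k ≤ c) → x ≤ℝ const c
≤ℝ-const x c x≤c m = p≤q⇒-r≤q-p (2⁻ m) (0≤2⁻ m) (x≤c (ℕ.suc m))

corollary4p2 : (n : ℕ) (α β : ℕ → Tern) → initSeg α n ≡ initSeg β n →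
    ∣ Φ α −ℝ Φ β ∣ℝ ≤ℝ const (2⁻ n)
corollary4p2 n α β eq = ≤ℝ-const _ (2⁻ n) (λ k → ∣Φ-Φ∣≤2⁻ α β eq (ℕ.suc k))
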